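{- Let $r\ge 2$ and let $H$ be an $r$-uniform intersecting hypergraph with $\tau(H)=r$. Then every vertex of $H$ that lies in at least one edge lies in at least two edges.
   Context: A hypergraph is $r$-uniform if every edge has exactly $r$ vertices, and intersecting if any two edges share at least one vertex. The covering number $\tau(H)$ is the minimum size of a set of vertices meeting every edge. The degree of a vertex is the number of edges containing it. -}

module Defs where

open import Data.Nat using (ℕ; _<_; _≤_)
open import Data.Fin using (Fin)
open import Data.Fin.Subset using (Subset; _∈_; ∣_∣; Nonempty)
open import Data.Product using (Σ; _×_; ∃; ∃-syntax)
open import Relation.Binary.PropositionalEquality using (_≡_; _≢_)
open import Function.Definitions using (Injective)

-- A (finite) hypergraph on vertex set Fin n with m edges, given by an
-- indexing of its edges by Fin m.  Edges are sets, so distinct indices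
-- must give distinct edges (injectivity).
record Hypergraph (n : ℕ) : Set where
  field
    m     : ℕ
    edge  : Fin m → Subset n
    edge-injective : Injective _≡_ _≡_ edge

open Hypergraph public

Uniform : {n : ℕ} → ℕ → Hypergraph n → Set
Uniform r H = ∀ e → ∣ edge H e ∣ ≡ r

Intersecting : {n : ℕ} → Hypergraph n → Set
Intersecting H = ∀ e f → ∃[ v ] (v ∈ edge H e × v ∈ edge H f)

IsCover : {n : ℕ} → Hypergraph n → Subset n → Set
IsCover H T = ∀ e → ∃[ v ] (v ∈ T × v ∈ edge H e)

CoveringNumber : {n : ℕ} → Hypergraph n → ℕ → Set
CoveringNumber H k =
  (∃[ T ] (IsCover H T × ∣ T ∣ ≡ k)) × (∀ T → IsCover H T → k ≤ ∣ T ∣)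

InSomeEdge : {n : ℕ} → Hypergraph n → Fin n → Set
InSomeEdge H v = ∃[ e ] (v ∈ edge H e)

InTwoEdges : {n : ℕ} → Hypergraph n → Fin n → Set
InTwoEdges H v = ∃[ e ] ∃[ f ] (e ≢ f × v ∈ edge H e × v ∈ edge H f)

module Submission where

open import Defs
open import Data.Nat using (ℕ; _≤_; _<_)
open import Data.Nat.Properties using (<⇒≱)
open import Data.Fin using (Fin; _≟_)
open import Data.Fin.Subset using (Subset; _∈_; _⊆_; ∣_∣; _-_; ⁅_⁆; Nonempty; Empty)
open import Data.Fin.Subset.Properties
  using (_∈?_; nonempty?; x∈⁅x⁆; ∣⁅x⁆∣≡1; p⊆q⇒∣p∣≤∣q∣; p─q⊆p; x∈p∧x≢y⇒x∈p-y; x∈p⇒∣p-x∣<∣p∣)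
open import Data.Fin.Properties using (any?)
open import Data.Product using (_,_)
open import Data.Sum using (_⊎_; inj₁; inj₂)
open import Relation.Nullary using (yes; no; ¬?)
open import Relation.Nullary.Decidable using (_×-dec_)
open import Relation.Nullary.Negation using (contradiction)
open import Relation.Binary.PropositionalEquality using (_≡_; refl; sym; subst)

-- If a vertex v of an edge e lay in no other edge, then e - v would still
-- meet every edge (by the intersecting property, through a vertex other than
-- v), giving a cover of size r - 1 < τ(H).

Empty[p-x]⇒p⊆⁅x⁆ : ∀ {n} {p : Subset n} {x : Fin n} → Empty (p - x) → p ⊆ ⁅ x ⁆
Empty[p-x]⇒p⊆⁅x⁆ {x = x} p-x≡∅ {y} y∈p with y ≟ x
... | yes refl = x∈⁅x⁆ x
... | no y≢x  = contradiction (y , x∈p∧x≢y⇒x∈p-y y∈p y≢x) p-x≡∅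

1<∣p∣⇒Nonempty[p-x] : ∀ {n} {p : Subset n} (x : Fin n) → 1 < ∣ p ∣ → Nonempty (p - x)
1<∣p∣⇒Nonempty[p-x] {p = p} x 1<∣p∣ with nonempty? (p - x)
... | yes p-x≢∅ = p-x≢∅
... | no  p-x≡∅ = contradiction ∣p∣≤1 (<⇒≱ 1<∣p∣)
  where
  ∣p∣≤1 : ∣ p ∣ ≤ 1
  ∣p∣≤1 = subst (∣ p ∣ ≤_) (∣⁅x⁆∣≡1 x) (p⊆q⇒∣p∣≤∣q∣ (Empty[p-x]⇒p⊆⁅x⁆ p-x≡∅))

LiesOnlyIn : ∀ {n} (H : Hypergraph n) → Fin n → Fin (m H) → Set
LiesOnlyIn H v e = ∀ f → v ∈ edge H f → e ≡ f

inTwoEdges⊎liesOnlyIn : ∀ {n} (H : Hypergraph n) {v e} → v ∈ edge H e →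
  InTwoEdges H v ⊎ LiesOnlyIn H v e
inTwoEdges⊎liesOnlyIn H {v} {e} v∈e
  with any? (λ f → ¬? (e ≟ f) ×-dec (v ∈? edge H f))
... | yes (f , e≢f , v∈f) = inj₁ (e , f , e≢f , v∈e , v∈f)
... | no ¬other = inj₂ onlyIn
  where
  onlyIn : LiesOnlyIn H v e
  onlyIn f v∈f with e ≟ f
  ... | yes e≡f = e≡f
  ... | no  e≢f = contradiction (f , e≢f , v∈f) ¬other

liesOnlyIn⇒isCover[edge-v] : ∀ {n} (H : Hypergraph n) {v e} →
  Intersecting H → LiesOnlyIn H v e → Nonempty (edge H e - v) →
  IsCover H (edge H e - v)
liesOnlyIn⇒isCover[edge-v] H {v} {e} intersecting onlyIn (x , x∈e-v) f
  with e ≟ f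
... | yes refl = x , x∈e-v , p─q⊆p (edge H e) ⁅ v ⁆ x∈e-v
... | no  e≢f with intersecting e f
...   | w , w∈e , w∈f with w ≟ v
...     | yes refl = contradiction (onlyIn f w∈f) e≢f
...     | no  w≢v  = w , x∈p∧x≢y⇒x∈p-y w∈e w≢v , w∈f

mainTheorem6 : (r n : ℕ) → 2 ≤ r → (H : Hypergraph n) →
    Uniform r H → Intersecting H → CoveringNumber H r →
    (v : Fin n) → InSomeEdge H v → InTwoEdges H v
mainTheorem6 r n 2≤r H uniform intersecting (_ , r≤cover) v (e , v∈e)
  with inTwoEdges⊎liesOnlyIn H v∈e
... | inj₁ twoEdges = twoEdges
... | inj₂ onlyIn   = contradiction (r≤cover (edge H e - v) cover) (<⇒≱ ∣edge-v∣<r)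
  where
  cover : IsCover H (edge H e - v)
  cover = liesOnlyIn⇒isCover[edge-v] H intersecting onlyIn
            (1<∣p∣⇒Nonempty[p-x] v (subst (1 <_) (sym (uniform e)) 2≤r))
  ∣edge-v∣<r : ∣ edge H e - v ∣ < r
  ∣edge-v∣<r = subst (∣ edge H e - v ∣ <_) (uniform e) (x∈p⇒∣p-x∣<∣p∣ v∈e)
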